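{- Let $\mathcal{C}$ be a connected Stembridge crystal of type $A_{n-1}$ (weights normalized as in the context) and $\mathcal{Q}_{\mathcal{C}}$ its associated quasi-crystal structure. Let $x,y\in\mathcal{C}$ and $i\in I$ with $\widetilde e_i(x)=y$. Then $\ddot\varepsilon_i(x)=+\infty$ if and only if $\ddot\varepsilon_i(y)=+\infty$.
   Context: Fix $n\ge2$, $I=\{1,\dots,n-1\}$, $\alpha_i=\mathbf{e}_i-\mathbf{e}_{i+1}\in\mathbb{Z}^n$, standard inner product. A crystal of type $A_{n-1}$ is a non-empty set $\mathcal{C}$ with maps $\widetilde e_i,\widetilde f_i:\mathcal{C}\to\mathcal{C}\sqcup\{\bot\}$, $\widetilde\varepsilon_i,\widetilde\varphi_i:\mathcal{C}\to\mathbb{Z}\sqcup\{ -\infty\}$, $\mathrm{wt}:\mathcal{C}\to\mathbb{Z}^n$ such that (C1) $\widetilde e_i(x)=y\iff x=\widetilde f_i(y)$, and then $\mathrm{wt}(y)=\mathrm{wt}(x)+\alpha_i$, $\widetilde\varepsilon_i(y)=\widetilde\varepsilon_i(x)-1$, $\widetilde\varphi_i(y)=\widetilde\varphi_i(x)+1$; (C2) $\widetilde\varphi_i(x)=\widetilde\varepsilon_i(x)+\langle\mathrm{wt}(x),\alpha_i\rangle$; (C3) if $\widetilde\varepsilon_i(x)=-\infty$ then $\widetilde e_i(x)=\widetilde f_i(x)=\bot$. Seminormal: $\widetilde\varepsilon_i(x)=\max\{k:\widetilde e_i^k(x)\ne\bot\}$, $\widetilde\varphi_i(x)=\max\{k:\widetilde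 f_i^k(x)\ne\bot\}$. A Stembridge crystal is a seminormal crystal satisfying Stembridge's axioms S1, S2, S2$'$, S3, S3$'$ for simply-laced type (in S1: if $\widetilde e_i(x)=y$ and $j\neq i$ then $\widetilde\varepsilon_j(y)\in\{\widetilde\varepsilon_j(x),\widetilde\varepsilon_j(x)+1\}$, the latter only if $|i-j|=1$). Weight convention: weights are in $\mathbb{Z}^n$ normalized so that the highest weight is a partition; in particular all $\mathrm{wt}(x)$ have non-negative entries; $\mathrm{wt}_k(x)$ is the $k$-th entry. The associated structure $\mathcal{Q}_{\mathcal{C}}$ has the same set and weights, with $\ddot\varepsilon_i(x)=\widetilde\varepsilon_i(x)$ if $\widetilde\varepsilon_i(x)=\mathrm{wt}_{i+1}(x)$ and $\ddot\varepsilon_i(x)=+\infty$ otherwise; $\ddot e_i(x)=\widetilde e_i(x)$ if $\widetilde\varepsilon_i(x)=\mathrm{wt}_{i+1}(x)$ and $\bot$ otherwise; $\ddot\varphi_i(x)=\ddot\varepsilon_i(x)+\langle\mathrm{wt}(x),\alpha_i\rangle$; $\ddot f_i(x)=y$ iff $\ddot e_i(y)=x$. -}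

module Defs where

open import Data.Nat using (ℕ; zero; suc)
open import Data.Integer using (ℤ; +_; -[1+_]; _+_; _-_; _*_; _≤_; 0ℤ; 1ℤ)
open import Data.Fin using (Fin; zero; suc; inject₁; toℕ)
open import Data.Fin.Properties using () renaming (_≟_ to _≟ᶠ_)
open import Data.Maybe using (Maybe; just; nothing; _>>=_; Is-just)
open import Data.Product using (Σ; _×_; _,_; ∃)
open import Data.Sum using (_⊎_)
open import Relation.Nullary using (¬_; does)
open import Data.Bool using (if_then_else_)
open import Relation.Binary.PropositionalEquality using (_≡_; _≢_)
open import Relation.Binary.Construct.Closure.ReflexiveTransitive using (Star)
import Data.Integer.Properties as ℤP

-- We write n = suc m, so weights live in ℤ^n = (Fin (suc m) → ℤ)
-- and the index set I = {1,…,n-1} is Fin m: the index i : Fin m stands for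
-- the (1-based) index toℕ i + 1.  Coordinate "i" of a weight is
-- position (inject₁ i) and coordinate "i+1" is position (suc i).

data ℤ₋∞ : Set where
  -∞  : ℤ₋∞
  fin : ℤ → ℤ₋∞

data ℤ₊∞ : Set where
  +∞  : ℤ₊∞
  fin : ℤ → ℤ₊∞

_+₋_ : ℤ₋∞ → ℤ → ℤ₋∞
-∞    +₋ k = -∞
fin a +₋ k = fin (a + k)

_+₊_ : ℤ₊∞ → ℤ → ℤ₊∞
+∞    +₊ k = +∞
fin a +₊ k = fin (a + k)

⟨_,_⟩ : ∀ {n} → (Fin n → ℤ) → (Fin n → ℤ) → ℤ
⟨_,_⟩ {zero}  v w = 0ℤ
⟨_,_⟩ {suc n} v w = v zero * w zero + ⟨ (λ k → v (suc k)) , (λ k → w (suc k)) ⟩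

𝐞 : ∀ {n} → Fin n → Fin n → ℤ
𝐞 k l = if does (k ≟ᶠ l) then 1ℤ else 0ℤ

α : ∀ {m} → Fin m → Fin (suc m) → ℤ
α i l = 𝐞 (inject₁ i) l - 𝐞 (suc i) l

iter : {C : Set} → (C → Maybe C) → ℕ → C → Maybe C
iter g zero    x = just x
iter g (suc k) x = iter g k x >>= g

Adjacent : ∀ {m} → Fin m → Fin m → Set
Adjacent i j = toℕ i ≡ suc (toℕ j) ⊎ toℕ j ≡ suc (toℕ i)

record Crystal (m : ℕ) : Set₁ where
  field
    Carrier : Set
    inhabited : Carrier
    e f : Fin m → Carrier → Maybe Carrier     -- nothing = ⊥
    ε φ : Fin m → Carrier → ℤ₋∞
    wt  : Carrier → Fin (suc m) → ℤ
    e⇒f : ∀ i x y → e i x ≡ just y → f i y ≡ just x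
    f⇒e : ∀ i x y → f i y ≡ just x → e i x ≡ just y
    e-wt : ∀ i x y → e i x ≡ just y → ∀ l → wt y l ≡ wt x l + α i l
    e-ε  : ∀ i x y → e i x ≡ just y → ε i y ≡ ε i x +₋ (-[1+ 0 ])
    e-φ  : ∀ i x y → e i x ≡ just y → φ i y ≡ φ i x +₋ 1ℤ
    φ-ε  : ∀ i x → φ i x ≡ ε i x +₋ ⟨ wt x , α i ⟩
    -∞-e : ∀ i x → ε i x ≡ -∞ → e i x ≡ nothing
    -∞-f : ∀ i x → ε i x ≡ -∞ → f i x ≡ nothing

module _ {m : ℕ} (C : Crystal m) where
  open Crystal C

  Seminormal : Set
  Seminormal =
    (∀ i x → Σ ℕ λ k → ε i x ≡ fin (+ k) × Is-just (iter (e i) k x)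
                        × iter (e i) (suc k) x ≡ nothing)
    × (∀ i x → Σ ℕ λ k → φ i x ≡ fin (+ k) × Is-just (iter (f i) k x)
                        × iter (f i) (suc k) x ≡ nothing)

  S1 : Set
  S1 = ∀ i j x y → i ≢ j → e i x ≡ just y →
         ε j y ≡ ε j x ⊎ (ε j y ≡ ε j x +₋ 1ℤ × Adjacent i j)

  S2 : Set
  S2 = ∀ i j x y z → i ≢ j → e i x ≡ just y → e j x ≡ just z →
         ε j y ≡ ε j x →
         Σ Carrier λ w → e j y ≡ just w × e i z ≡ just w × φ i z ≡ φ i x

  S2′ : Set
  S2′ = ∀ i j x y z → i ≢ j → f i x ≡ just y → f j x ≡ just z →
         φ j y ≡ φ j x →
         Σ Carrier λ w → f j y ≡ just w × f i z ≡ just w × ε i z ≡ ε i x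

  -- y = ẽ_i x, z = ẽ_j x, a = ẽ_j² y, b = ẽ_i² z,
  -- w = ẽ_i ẽ_j² ẽ_i x = ẽ_j ẽ_i² ẽ_j x, with φ̃_j(f̃_i w) = φ̃_j(w)+1, φ̃_i(f̃_j w) = φ̃_i(w)+1
  S3 : Set
  S3 = ∀ i j x y z → i ≢ j → e i x ≡ just y → e j x ≡ just z →
         ε j y ≡ ε j x +₋ 1ℤ → ε i z ≡ ε i x +₋ 1ℤ →
         Σ Carrier λ w → Σ Carrier λ a → Σ Carrier λ b →
           iter (e j) 2 y ≡ just a × e i a ≡ just w ×
           iter (e i) 2 z ≡ just b × e j b ≡ just w ×
           φ j a ≡ φ j w +₋ 1ℤ × φ i b ≡ φ i w +₋ 1ℤ

  S3′ : Set
  S3′ = ∀ i j x y z → i ≢ j → f i x ≡ just y → f j x ≡ just z →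
         φ j y ≡ φ j x +₋ 1ℤ → φ i z ≡ φ i x +₋ 1ℤ →
         Σ Carrier λ w → Σ Carrier λ a → Σ Carrier λ b →
           iter (f j) 2 y ≡ just a × f i a ≡ just w ×
           iter (f i) 2 z ≡ just b × f j b ≡ just w ×
           ε j a ≡ ε j w +₋ 1ℤ × ε i b ≡ ε i w +₋ 1ℤ

  Stembridge : Set
  Stembridge = Seminormal × S1 × S2 × S2′ × S3 × S3′

  Edge : Carrier → Carrier → Set
  Edge x y = ∃ λ i → e i x ≡ just y ⊎ f i x ≡ just y

  Connected : Set
  Connected = ∀ x y → Star Edge x y

  IsPartition : (Fin (suc m) → ℤ) → Set
  IsPartition λ′ = (∀ l → 0ℤ ≤ λ′ l) × (∀ (k : Fin m) → λ′ (suc k) ≤ λ′ (inject₁ k))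

  WeightNormalised : Set
  WeightNormalised =
    (Σ Carrier λ u → (∀ i → e i u ≡ nothing) × IsPartition (wt u))
    × (∀ x l → 0ℤ ≤ wt x l)

  ε̈ : Fin m → Carrier → ℤ₊∞
  ε̈ i x with ε i x
  ... | -∞    = +∞
  ... | fin k = if does (k ℤP.≟ wt x (suc i)) then fin k else +∞

  ë : Fin m → Carrier → Maybe Carrier
  ë i x with ε i x
  ... | -∞    = nothing
  ... | fin k = if does (k ℤP.≟ wt x (suc i)) then e i x else nothing

  φ̈ : Fin m → Carrier → ℤ₊∞
  φ̈ i x = ε̈ i x +₊ ⟨ wt x , α i ⟩

-- Only axioms (C1) and (C3) are needed: ẽ_i lowers both ε̃_i and the (i+1)-th
-- weight coordinate by one, so the condition ε̃_i = wt_{i+1}, which decides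
-- whether ε̈_i is finite, holds at x exactly when it holds at ẽ_i x.
module Submission where

open import Defs
open import Data.Nat using (ℕ; _≤_)
open import Data.Fin using (Fin; zero; suc; inject₁)
import Data.Fin.Properties as FP
open import Data.Integer using (_+_; _-_; 0ℤ; 1ℤ; -1ℤ)
import Data.Integer.Properties as ℤP
open import Algebra.Bundles using (AbelianGroup)
open import Algebra.Properties.Group (AbelianGroup.group ℤP.+-0-abelianGroup) using (∙-cancelʳ)
open import Data.Maybe using (just)
open import Data.Product using (∃; _,_)
open import Data.Empty using (⊥-elim)
open import Relation.Nullary using (yes; no)
open import Relation.Binary.PropositionalEquality
  using (_≡_; _≢_; refl; sym; trans; cong; cong₂; subst)
open import Function.Bundles using (_⇔_; mk⇔)
open import Function.Base using (_∘_)
open import Function.Properties.Equivalence using () renaming (trans to ⇔-trans; sym to ⇔-sym)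

inject₁≢suc : ∀ {m} (i : Fin m) → inject₁ i ≢ suc i
inject₁≢suc zero    ()
inject₁≢suc (suc i) eq = inject₁≢suc i (FP.suc-injective eq)

𝐞-diagonal : ∀ {n} (k : Fin n) → 𝐞 k k ≡ 1ℤ
𝐞-diagonal k with k FP.≟ k
... | yes _  = refl
... | no k≢k = ⊥-elim (k≢k refl)

𝐞-off-diagonal : ∀ {n} {k l : Fin n} → k ≢ l → 𝐞 k l ≡ 0ℤ
𝐞-off-diagonal {k = k} {l} k≢l with k FP.≟ l
... | yes k≡l = ⊥-elim (k≢l k≡l)
... | no _    = refl

α-at-suc : ∀ {m} (i : Fin m) → α i (suc i) ≡ -1ℤ
α-at-suc i = cong₂ _-_ (𝐞-off-diagonal (inject₁≢suc i)) (𝐞-diagonal (suc i))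

≢-+-shiftʳ : ∀ {a b} c → a ≢ b ⇔ a + c ≢ b + c
≢-+-shiftʳ {a} {b} c = mk⇔ (λ a≢b eq → a≢b (∙-cancelʳ c a b eq)) (λ ≢+c → ≢+c ∘ cong (_+ c))

module _ {m : ℕ} (C : Crystal m) where
  open Crystal C

  ε̈≡+∞⇔ε≢wt : ∀ i x {k} → ε i x ≡ fin k → ε̈ C i x ≡ +∞ ⇔ k ≢ wt x (suc i)
  ε̈≡+∞⇔ε≢wt i x {k} _ with ε i x
  ε̈≡+∞⇔ε≢wt i x {k} refl | fin .k with k ℤP.≟ wt x (suc i)
  ... | yes k≡w = mk⇔ (λ ()) (λ k≢w → ⊥-elim (k≢w k≡w))
  ... | no k≢w  = mk⇔ (λ _ → k≢w) (λ _ → refl)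

  e-defined⇒ε-finite : ∀ {i x y} → e i x ≡ just y → ∃ λ k → ε i x ≡ fin k
  e-defined⇒ε-finite {i} {x} ex with ε i x in εx
  ... | fin k = k , refl
  ... | -∞ with trans (sym (-∞-e i x εx)) ex
  ...        | ()

  ε̈≡+∞-invariant-e : ∀ {i x y} → e i x ≡ just y → ε̈ C i x ≡ +∞ ⇔ ε̈ C i y ≡ +∞
  ε̈≡+∞-invariant-e {i} {x} {y} ex with e-defined⇒ε-finite ex
  ... | k , εx =
    ⇔-trans (ε̈≡+∞⇔ε≢wt i x εx)
   (⇔-trans (≢-+-shiftʳ -1ℤ)
   (⇔-trans (mk⇔ (subst (_ ≢_) (sym wty)) (subst (_ ≢_) wty))
            (⇔-sym (ε̈≡+∞⇔ε≢wt i y εy))))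
    where
    εy : ε i y ≡ fin (k + -1ℤ)
    εy = trans (e-ε i x y ex) (cong (_+₋ -1ℤ) εx)
    wty : wt y (suc i) ≡ wt x (suc i) + -1ℤ
    wty = trans (e-wt i x y ex (suc i)) (cong (wt x (suc i) +_) (α-at-suc i))

lemma4p6 : (m : ℕ) → 1 ≤ m → (C : Crystal m) →
    Stembridge C → Connected C → WeightNormalised C →
    ∀ (x y : Crystal.Carrier C) (i : Fin m) → Crystal.e C i x ≡ just y →
    (ε̈ C i x ≡ +∞) ⇔ (ε̈ C i y ≡ +∞)
lemma4p6 m _ C _ _ _ x y i = ε̈≡+∞-invariant-e C
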